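{- $\mathrm{CSP}(\{ -,\cup,\cap,+,\times\})\in\Sigma_2$ (the second existential level of the arithmetical hierarchy).
   Context: Set operations on subsets of $\mathbb{N}=\{0,1,2,\dots\}$: $-A=\mathbb{N}\setminus A$, $\cup$, $\cap$ as usual, $A+B=\{a+b: a\in A,b\in B\}$, $A\times B=\{ab: a\in A,b\in B\}$. For $\mathcal{O}\subseteq\{ -,\cup,\cap,+,\times\}$, an $\mathcal{O}$-term is built from variables and constants $c\in\mathbb{N}$ (denoting $\{c\}$) using operations in $\mathcal{O}$. $\mathrm{CSP}(\mathcal{O})$ is the problem: given $\exists y_1\dots\exists y_n\bigwedge_{i=1}^m(s_i=t_i)$ with $s_i,t_i$ $\mathcal{O}$-terms in $y_1,\dots,y_n$, decide whether there exist $a_1,\dots,a_n\in\mathbb{N}$ such that, with each $y_j$ interpreted as $\{a_j\}$, every $s_i=t_i$ holds as an equality of subsets of $\mathbb{N}$. -}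

module Defs where

open import Data.Nat using (ℕ; _+_; _*_)
open import Data.Fin using (Fin)
open import Data.Bool using (Bool; true)
open import Data.List using (List)
open import Data.List.Relation.Unary.All using (All)
open import Data.Product using (Σ; ∃; ∃-syntax; _×_; _,_)
open import Data.Sum using (_⊎_)
open import Relation.Nullary using (¬_)
open import Relation.Binary.PropositionalEquality using (_≡_)
open import Function.Bundles using (_⇔_)
open import Axiom.ExcludedMiddle using (ExcludedMiddle)
open import Level using (0ℓ)

data Term (n : ℕ) : Set where
  var   : Fin n → Term n
  const : ℕ → Term n
  compl : Term n → Term n
  _∪ₜ_  : Term n → Term n → Term n
  _∩ₜ_  : Term n → Term n → Term n
  _+ₜ_  : Term n → Term n → Term n
  _×ₜ_  : Term n → Term n → Term n

-- membership semantics: each variable y_j denotes the singleton {ρ j}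
_∈⟦_⟧_ : {n : ℕ} → ℕ → Term n → (Fin n → ℕ) → Set
x ∈⟦ var j ⟧ ρ = x ≡ ρ j
x ∈⟦ const c ⟧ ρ = x ≡ c
x ∈⟦ compl s ⟧ ρ = ¬ (x ∈⟦ s ⟧ ρ)
x ∈⟦ s ∪ₜ t ⟧ ρ = (x ∈⟦ s ⟧ ρ) ⊎ (x ∈⟦ t ⟧ ρ)
x ∈⟦ s ∩ₜ t ⟧ ρ = (x ∈⟦ s ⟧ ρ) × (x ∈⟦ t ⟧ ρ)
x ∈⟦ s +ₜ t ⟧ ρ = ∃[ a ] ∃[ b ] ((a ∈⟦ s ⟧ ρ) × (b ∈⟦ t ⟧ ρ) × (x ≡ a + b))
x ∈⟦ s ×ₜ t ⟧ ρ = ∃[ a ] ∃[ b ] ((a ∈⟦ s ⟧ ρ) × (b ∈⟦ t ⟧ ρ) × (x ≡ a * b))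

record Equation (n : ℕ) : Set where
  constructor _≐_
  field
    lhs : Term n
    rhs : Term n

Holds : {n : ℕ} → Equation n → (Fin n → ℕ) → Set
Holds (s ≐ t) ρ = ∀ x → (x ∈⟦ s ⟧ ρ) ⇔ (x ∈⟦ t ⟧ ρ)

record Instance : Set where
  constructor inst
  field
    nvars : ℕ
    eqs   : List (Equation nvars)

Satisfiable : Instance → Set
Satisfiable (inst n es) = Σ (Fin n → ℕ) λ ρ → All (λ e → Holds e ρ) es

-- Σ₂ of the arithmetical hierarchy: P(x) ⇔ ∃a ∀b R(x,a,b) for a computable
-- (Agda-definable, total, Bool-valued) R. The equivalence is a classical
-- fact, so it is proved under excluded middle; R itself must be given
-- without it (it is chosen before the LEM hypothesis).
InΣ₂ : {A : Set} → (A → Set) → Set₁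
InΣ₂ {A} P = Σ (A → ℕ → ℕ → Bool) λ R →
  ExcludedMiddle 0ℓ → ∀ x → P x ⇔ (∃[ a ] ∀ b → R x a b ≡ true)

-- A solution of an instance can be certified by finitely much data: the values of the
-- variables, and for every product subterm s × u a witness of nonemptiness (or the claim of
-- emptiness) for each of s and u. Given such data, membership x ∈ t becomes decidable:
-- complement, union and intersection are pointwise, a + b = x forces a, b ≤ x, and
-- a * b = x forces a, b ≤ x unless x = 0, where 0 ∈ s × u iff 0 lies in one factor and
-- the other factor is nonempty. Each guessed witness is then confirmed by a single
-- membership test and each claim of emptiness by a test at every point, so the
-- certificate is correct iff a decidable check succeeds at every b ∈ ℕ. Hence
-- satisfiability is "∃ certificate ∀ b, check", which is Σ₂.
module Submission where

open import Defs
open import Axiom.ExcludedMiddle using (ExcludedMiddle)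
open import Data.Bool using (Bool; true; false; T; not; _∧_; _∨_)
open import Data.Bool.Properties using (T-≡; T-∧; T-∨) renaming (_≟_ to _≟ᵇ_)
open import Data.Empty using (⊥-elim)
open import Data.Fin using (Fin)
open import Data.List using (List; []; _∷_)
open import Data.List.Relation.Unary.All as All using (All; []; _∷_)
open import Data.Maybe using (Maybe; nothing; just; is-just)
open import Data.Nat using (ℕ; zero; suc; _+_; _*_; _∸_; _<_; _≡ᵇ_; s≤s)
open import Data.Nat.Divisibility using (_∣_; ∣⇒≤; m∣m*n; n∣m*n)
open import Data.Nat.Properties
  using (anyUpTo?; ≤-pred; ≡ᵇ⇒≡; ≡⇒≡ᵇ; +-suc; +-identityʳ; m≤m+n; m+n∸m≡n; m+[n∸m]≡n; *-zeroʳ)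
open import Data.Product as Product using (Σ; ∃; ∃-syntax; _×_; _,_; proj₁; proj₂; zip)
open import Data.Product.Function.NonDependent.Propositional using (_×-⇔_; _×-↠_)
open import Data.Sum as Sum using (_⊎_; inj₁; inj₂)
open import Data.Sum.Function.Propositional using (_⊎-⇔_)
open import Data.Unit using (⊤; tt)
open import Data.Vec using (Vec; []; _∷_; lookup; tabulate)
open import Data.Vec.Properties using (lookup∘tabulate)
open import Function using (_∘_; id)
open import Function.Bundles using (_⇔_; mk⇔; Equivalence; _↠_; mk↠ₛ; Surjection)
open import Function.Construct.Composition using (_⇔-∘_; _↠-∘_)
open import Function.Construct.Identity using (↠-id)
open import Function.Construct.Symmetry using (⇔-sym)
open import Function.Definitions using (StrictlySurjective)
open import Function.Related.TypeIsomorphisms using (¬-cong-⇔)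
open import Level using (0ℓ)
open import Relation.Nullary using (¬_; yes; no)
open import Relation.Nullary.Decidable using (⌊_⌋; T?; toWitness; fromWitness)
open import Relation.Binary.PropositionalEquality using (_≡_; refl; sym; trans; cong; subst)

open Equivalence using (to; from)

T-not : ∀ {x} → T (not x) ⇔ (¬ T x)
T-not {false} = mk⇔ (λ _ ()) (λ _ → tt)
T-not {true}  = mk⇔ (λ ()) (λ ¬t → ¬t tt)

T-≡-⇔ : ∀ {x y} → (x ≡ y) ⇔ (T x ⇔ T y)
T-≡-⇔ {false} {false} = mk⇔ (λ _ → mk⇔ id id) (λ _ → refl)
T-≡-⇔ {true}  {true}  = mk⇔ (λ _ → mk⇔ id id) (λ _ → refl)
T-≡-⇔ {false} {true}  = mk⇔ (λ ()) (λ e → ⊥-elim (from e tt))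
T-≡-⇔ {true}  {false} = mk⇔ (λ ()) (λ e → ⊥-elim (to e tt))

∀-T-∧ : {p q : ℕ → Bool} → (∀ b → T (p b ∧ q b)) ⇔ ((∀ b → T (p b)) × (∀ b → T (q b)))
∀-T-∧ = mk⇔ (λ h → proj₁ ∘ to T-∧ ∘ h , proj₂ ∘ to T-∧ ∘ h)
            (λ (hp , hq) b → from T-∧ (hp b , hq b))

_×-⇔-dependent_ : {A A′ B B′ : Set} → A ⇔ A′ → (A′ → B ⇔ B′) → (A × B) ⇔ (A′ × B′)
A⇔A′ ×-⇔-dependent B⇔B′ = mk⇔ (λ (a , b) → let a′ = to A⇔A′ a in a′ , to (B⇔B′ a′) b)
                             (λ (a′ , b′) → from A⇔A′ a′ , from (B⇔B′ a′) b′)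

anyBelow : (ℕ → Bool) → ℕ → Bool
anyBelow p v = ⌊ anyUpTo? (T? ∘ p) v ⌋

T-anyBelow : ∀ {p v} → T (anyBelow p v) ⇔ (∃ λ a → a < v × T (p a))
T-anyBelow = mk⇔ toWitness fromWitness

nextPair : ℕ × ℕ → ℕ × ℕ
nextPair (zero  , j) = (suc j , 0)
nextPair (suc i , j) = (i , suc j)

unpair : ℕ → ℕ × ℕ
unpair zero    = (0 , 0)
unpair (suc n) = nextPair (unpair n)

unpair-surjective : StrictlySurjective _≡_ unpair
unpair-surjective (i , j) = along-diagonal j i (diagonal-start (i + j))
  where
  along-diagonal : ∀ j i → ∃ (λ n → unpair n ≡ (i + j , 0)) → ∃ λ n → unpair n ≡ (i , j)
  along-diagonal zero    i (n , eq) = n , subst (λ k → unpair n ≡ (k , 0)) (+-identityʳ i) eq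
  along-diagonal (suc j) i (n , eq) with along-diagonal j (suc i) (n , trans eq (cong (_, 0) (+-suc i j)))
  ... | m , eq′ = suc m , cong nextPair eq′

  diagonal-start : ∀ d → ∃ λ n → unpair n ≡ (d , 0)
  diagonal-start zero    = 0 , refl
  diagonal-start (suc d) with along-diagonal d 0 (diagonal-start d)
  ... | n , eq = suc n , cong nextPair eq

ℕ↠ℕ×ℕ : ℕ ↠ (ℕ × ℕ)
ℕ↠ℕ×ℕ = mk↠ₛ unpair-surjective

ℕ↠⊤ : ℕ ↠ ⊤
ℕ↠⊤ = mk↠ₛ {to = λ _ → tt} (λ _ → 0 , refl)

ℕ↠Maybe : ℕ ↠ Maybe ℕ
ℕ↠Maybe = mk↠ₛ {to = λ { zero → nothing ; (suc n) → just n }}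
                λ { nothing → 0 , refl ; (just n) → suc n , refl }

ℕ↠× : {A B : Set} → ℕ ↠ A → ℕ ↠ B → ℕ ↠ (A × B)
ℕ↠× f g = (f ×-↠ g) ↠-∘ ℕ↠ℕ×ℕ

ℕ↠Vec : {A : Set} → ℕ ↠ A → ∀ n → ℕ ↠ Vec A n
ℕ↠Vec f zero    = mk↠ₛ {to = λ _ → []} λ { [] → 0 , refl }
ℕ↠Vec {A} f (suc n) = cons ↠-∘ ℕ↠× f (ℕ↠Vec f n)
  where
  cons : (A × Vec A n) ↠ Vec A (suc n)
  cons = mk↠ₛ {to = λ (x , xs) → x ∷ xs} λ { (x ∷ xs) → (x , xs) , refl }

certificates⇒InΣ₂ : {A : Set} {P : A → Set} (C : A → Set) → (∀ x → ℕ ↠ C x) →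
                       (check : ∀ x → C x → ℕ → Bool) →
                       (ExcludedMiddle 0ℓ → ∀ x → P x ⇔ (∃[ c ] ∀ b → T (check x c b))) →
                       InΣ₂ P
certificates⇒InΣ₂ C enum check certified =
  (λ x a b → check x (decode x a) b) , λ lem x → mk⇔
    (λ Px → let c , h = to (certified lem x) Px
                a , a↦c = Surjection.strictlySurjective (enum x) c
            in a , λ b → to T-≡ (subst (λ c → T (check x c b)) (sym a↦c) (h b)))
    (λ (a , h) → from (certified lem x) (decode x a , λ b → from T-≡ (h b)))
  where
  decode : ∀ x → ℕ → C x
  decode x = Surjection.to (enum x)

module _ {A : Set} (G : A → Set) where

  Certificates : List A → Set
  Certificates []       = ⊤
  Certificates (a ∷ as) = G a × Certificates as

  ℕ↠Certificates : (∀ a → ℕ ↠ G a) → ∀ as → ℕ ↠ Certificates as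
  ℕ↠Certificates enum []       = ℕ↠⊤
  ℕ↠Certificates enum (a ∷ as) = ℕ↠× (enum a) (ℕ↠Certificates enum as)

module _ {A : Set} {G : A → Set} (check : ∀ a → G a → ℕ → Bool) where

  checkAll : ∀ as → Certificates G as → ℕ → Bool
  checkAll []       _        _ = true
  checkAll (a ∷ as) (g , gs) b = check a g b ∧ checkAll as gs b

  All-certified : {P : A → Set} → (∀ a → P a ⇔ (∃[ g ] ∀ b → T (check a g b))) →
                  ∀ as → All P as ⇔ (∃[ gs ] ∀ b → T (checkAll as gs b))
  All-certified certified []       = mk⇔ (λ _ → tt , λ _ → tt) (λ _ → [])
  All-certified {P} certified (a ∷ as) = mk⇔ certify split
    where
    certify : All P (a ∷ as) → ∃[ gs ] ∀ b → T (checkAll (a ∷ as) gs b)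
    certify (pa ∷ pas) with to (certified a) pa | to (All-certified certified as) pas
    ... | g , hg | gs , hgs = (g , gs) , from ∀-T-∧ (hg , hgs)

    split : ∃[ gs ] (∀ b → T (checkAll (a ∷ as) gs b)) → All P (a ∷ as)
    split ((g , gs) , h) with to ∀-T-∧ h
    ... | hg , hgs = from (certified a) (g , hg) ∷ from (All-certified certified as) (gs , hgs)

Decides : (ℕ → Bool) → (ℕ → Set) → Set
Decides p P = ∀ x → T (p x) ⇔ P x

_⊕_ _⊗_ : (ℕ → Set) → (ℕ → Set) → ℕ → Set
(P ⊕ Q) x = ∃[ a ] ∃[ b ] (P a × Q b × x ≡ a + b)
(P ⊗ Q) x = ∃[ a ] ∃[ b ] (P a × Q b × x ≡ a * b)

decides-≡ : ∀ c → Decides (_≡ᵇ c) (_≡ c)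
decides-≡ c x = mk⇔ (≡ᵇ⇒≡ x c) (≡⇒≡ᵇ x c)

decides-¬ : ∀ {p P} → Decides p P → Decides (not ∘ p) (¬_ ∘ P)
decides-¬ d x = ¬-cong-⇔ (d x) ⇔-∘ T-not

decides-⊎ : ∀ {p q P Q} → Decides p P → Decides q Q → Decides (λ x → p x ∨ q x) (λ x → P x ⊎ Q x)
decides-⊎ dp dq x = (dp x ⊎-⇔ dq x) ⇔-∘ T-∨

decides-× : ∀ {p q P Q} → Decides p P → Decides q Q → Decides (λ x → p x ∧ q x) (λ x → P x × Q x)
decides-× dp dq x = (dp x ×-⇔ dq x) ⇔-∘ T-∧

decides-agree : ∀ {p q P Q} → Decides p P → Decides q Q →
                (∀ x → T ⌊ p x ≟ᵇ q x ⌋) ⇔ (∀ x → P x ⇔ Q x)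
decides-agree dp dq = mk⇔
  (λ h x → dq x ⇔-∘ (to T-≡-⇔ (toWitness (h x)) ⇔-∘ ⇔-sym (dp x)))
  (λ h x → fromWitness (from T-≡-⇔ (⇔-sym (dq x) ⇔-∘ (h x ⇔-∘ dp x))))

sum-search : (ℕ → Bool) → (ℕ → Bool) → ℕ → Bool
sum-search p q x = anyBelow (λ a → p a ∧ q (x ∸ a)) (suc x)

decides-⊕ : ∀ {p q P Q} → Decides p P → Decides q Q → Decides (sum-search p q) (P ⊕ Q)
decides-⊕ {q = q} dp dq x = mk⇔
  (λ h → let a , a<1+x , pq = to T-anyBelow h
             pa , qb = to T-∧ pq
         in a , x ∸ a , to (dp a) pa , to (dq (x ∸ a)) qb , sym (m+[n∸m]≡n (≤-pred a<1+x)))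
  (λ { (a , b , Pa , Qb , refl) → from T-anyBelow
         (a , s≤s (m≤m+n a b) ,
          from T-∧ (from (dp a) Pa , subst (T ∘ q) (sym (m+n∸m≡n a b)) (from (dq b) Qb))) })

IsWitness : (ℕ → Set) → Maybe ℕ → Set
IsWitness P nothing  = ∀ x → ¬ P x
IsWitness P (just w) = P w

witness-check : (ℕ → Bool) → Maybe ℕ → ℕ → Bool
witness-check p nothing  b = not (p b)
witness-check p (just w) _ = p w

witness-check-correct : ∀ {p P} → Decides p P → ∀ w → (∀ b → T (witness-check p w b)) ⇔ IsWitness P w
witness-check-correct d nothing  = mk⇔ (λ h x Px → to T-not (h x) (from (d x) Px))
                                       (λ h b → from T-not (h b ∘ to (d b)))
witness-check-correct d (just w) = mk⇔ (λ h → to (d w) (h 0)) (λ Pw _ → from (d w) Pw)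

witness-exists : ExcludedMiddle 0ℓ → (P : ℕ → Set) → ∃ (IsWitness P)
witness-exists lem P with lem {∃ P}
... | yes (w , Pw) = just w , Pw
... | no  ∄P       = nothing , λ x Px → ∄P (x , Px)

is-just-nonempty : ∀ {P} w → IsWitness P w → T (is-just w) ⇔ ∃ P
is-just-nonempty nothing  empty = mk⇔ (λ ()) (λ (x , Px) → empty x Px)
is-just-nonempty (just w) Pw    = mk⇔ (λ _ → w , Pw) (λ _ → tt)

product-search : Maybe ℕ → Maybe ℕ → (ℕ → Bool) → (ℕ → Bool) → ℕ → Bool
product-search wp wq p q zero    = (p 0 ∧ is-just wq) ∨ (q 0 ∧ is-just wp)
product-search wp wq p q (suc x) =
  anyBelow (λ a → anyBelow (λ b → (a * b ≡ᵇ suc x) ∧ (p a ∧ q b)) (suc (suc x))) (suc (suc x))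

factor-bounds : ∀ {x} a b → suc x ≡ a * b → a < suc (suc x) × b < suc (suc x)
factor-bounds a b eq =
  s≤s (∣⇒≤ (subst (a ∣_) (sym eq) (m∣m*n b))) , s≤s (∣⇒≤ (subst (b ∣_) (sym eq) (n∣m*n a)))

⊗-zero : ∀ {P Q} → (P ⊗ Q) 0 ⇔ ((P 0 × ∃ Q) ⊎ (Q 0 × ∃ P))
⊗-zero = mk⇔
  (λ { (zero  , b     , P0 , Qb , _) → inj₁ (P0 , b , Qb)
     ; (suc a , zero  , Pa , Q0 , _) → inj₂ (Q0 , suc a , Pa)
     ; (suc a , suc b , _  , _  , ()) })
  Sum.[ (λ (P0 , b , Qb) → 0 , b , P0 , Qb , refl)
      , (λ (Q0 , a , Pa) → a , 0 , Pa , Q0 , sym (*-zeroʳ a)) ]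

decides-⊗ : ∀ {p q P Q wp wq} → Decides p P → Decides q Q → IsWitness P wp → IsWitness Q wq →
            Decides (product-search wp wq p q) (P ⊗ Q)
decides-⊗ {wp = wp} {wq} dp dq Wp Wq zero =
  ⇔-sym ⊗-zero ⇔-∘ ((((dp 0 ×-⇔ is-just-nonempty wq Wq) ⇔-∘ T-∧)
                     ⊎-⇔ ((dq 0 ×-⇔ is-just-nonempty wp Wp) ⇔-∘ T-∧)) ⇔-∘ T-∨)
decides-⊗ dp dq _ _ (suc x) = mk⇔
  (λ h → let a , _ , h′ = to T-anyBelow h
             b , _ , h″ = to T-anyBelow h′
             ab≡x , pq = to T-∧ h″
             pa , qb = to T-∧ pq
         in a , b , to (dp a) pa , to (dq b) qb , sym (≡ᵇ⇒≡ (a * b) (suc x) ab≡x))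
  (λ (a , b , Pa , Qb , eq) → let a< , b< = factor-bounds a b eq in
    from T-anyBelow (a , a< , from T-anyBelow (b , b< ,
      from T-∧ (≡⇒≡ᵇ (a * b) (suc x) (sym eq) , from T-∧ (from (dp a) Pa , from (dq b) Qb)))))

module _ {n : ℕ} where

  Guesses : Term n → Set
  Guesses (var _)   = ⊤
  Guesses (const _) = ⊤
  Guesses (compl s) = Guesses s
  Guesses (s ∪ₜ u)  = Guesses s × Guesses u
  Guesses (s ∩ₜ u)  = Guesses s × Guesses u
  Guesses (s +ₜ u)  = Guesses s × Guesses u
  Guesses (s ×ₜ u)  = (Guesses s × Guesses u) × (Maybe ℕ × Maybe ℕ)

  ℕ↠Guesses : ∀ t → ℕ ↠ Guesses t
  ℕ↠Guesses (var _)   = ℕ↠⊤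
  ℕ↠Guesses (const _) = ℕ↠⊤
  ℕ↠Guesses (compl s) = ℕ↠Guesses s
  ℕ↠Guesses (s ∪ₜ u)  = ℕ↠× (ℕ↠Guesses s) (ℕ↠Guesses u)
  ℕ↠Guesses (s ∩ₜ u)  = ℕ↠× (ℕ↠Guesses s) (ℕ↠Guesses u)
  ℕ↠Guesses (s +ₜ u)  = ℕ↠× (ℕ↠Guesses s) (ℕ↠Guesses u)
  ℕ↠Guesses (s ×ₜ u)  = ℕ↠× (ℕ↠× (ℕ↠Guesses s) (ℕ↠Guesses u)) (ℕ↠× ℕ↠Maybe ℕ↠Maybe)

  ∈⟦⟧-cong : {ρ σ : Fin n → ℕ} → (∀ j → ρ j ≡ σ j) → ∀ t {x} → x ∈⟦ t ⟧ ρ → x ∈⟦ t ⟧ σ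
  ∈⟦⟧-cong ρ≗σ (var j)   x≡ρj                 = trans x≡ρj (ρ≗σ j)
  ∈⟦⟧-cong ρ≗σ (const c) x≡c                  = x≡c
  ∈⟦⟧-cong ρ≗σ (compl s) x∉s                  = x∉s ∘ ∈⟦⟧-cong (sym ∘ ρ≗σ) s
  ∈⟦⟧-cong ρ≗σ (s ∪ₜ u)  x∈s∪u                = Sum.map (∈⟦⟧-cong ρ≗σ s) (∈⟦⟧-cong ρ≗σ u) x∈s∪u
  ∈⟦⟧-cong ρ≗σ (s ∩ₜ u)  x∈s∩u                = Product.map (∈⟦⟧-cong ρ≗σ s) (∈⟦⟧-cong ρ≗σ u) x∈s∩u
  ∈⟦⟧-cong ρ≗σ (s +ₜ u)  (a , b , a∈s , b∈u , eq) = a , b , ∈⟦⟧-cong ρ≗σ s a∈s , ∈⟦⟧-cong ρ≗σ u b∈u , eq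
  ∈⟦⟧-cong ρ≗σ (s ×ₜ u)  (a , b , a∈s , b∈u , eq) = a , b , ∈⟦⟧-cong ρ≗σ s a∈s , ∈⟦⟧-cong ρ≗σ u b∈u , eq

  Holds-cong : {ρ σ : Fin n → ℕ} → (∀ j → ρ j ≡ σ j) → ∀ e → Holds e ρ → Holds e σ
  Holds-cong ρ≗σ (s ≐ u) h x = mk⇔ (∈⟦⟧-cong ρ≗σ u ∘ to (h x) ∘ ∈⟦⟧-cong (sym ∘ ρ≗σ) s)
                                   (∈⟦⟧-cong ρ≗σ s ∘ from (h x) ∘ ∈⟦⟧-cong (sym ∘ ρ≗σ) u)

  EquationGuesses : Equation n → Set
  EquationGuesses (s ≐ u) = Guesses s × Guesses u

  ℕ↠EquationGuesses : ∀ e → ℕ ↠ EquationGuesses e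
  ℕ↠EquationGuesses (s ≐ u) = ℕ↠× (ℕ↠Guesses s) (ℕ↠Guesses u)

module Guided {n : ℕ} (ρ : Fin n → ℕ) where

  mem : ∀ t → Guesses t → ℕ → Bool
  mem (var j)   _ x = x ≡ᵇ ρ j
  mem (const c) _ x = x ≡ᵇ c
  mem (compl s) g x = not (mem s g x)
  mem (s ∪ₜ u) (g , h) x = mem s g x ∨ mem u h x
  mem (s ∩ₜ u) (g , h) x = mem s g x ∧ mem u h x
  mem (s +ₜ u) (g , h)             = sum-search (mem s g) (mem u h)
  mem (s ×ₜ u) ((g , h) , ws , wu) = product-search ws wu (mem s g) (mem u h)

  Correct : ∀ t → Guesses t → Set
  Correct (var _)   _ = ⊤
  Correct (const _) _ = ⊤
  Correct (compl s) g = Correct s g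
  Correct (s ∪ₜ u) (g , h) = Correct s g × Correct u h
  Correct (s ∩ₜ u) (g , h) = Correct s g × Correct u h
  Correct (s +ₜ u) (g , h) = Correct s g × Correct u h
  Correct (s ×ₜ u) ((g , h) , ws , wu) =
    (Correct s g × Correct u h) × (IsWitness (_∈⟦ s ⟧ ρ) ws × IsWitness (_∈⟦ u ⟧ ρ) wu)

  check : ∀ t → Guesses t → ℕ → Bool
  check (var _)   _ _ = true
  check (const _) _ _ = true
  check (compl s) g b = check s g b
  check (s ∪ₜ u) (g , h) b = check s g b ∧ check u h b
  check (s ∩ₜ u) (g , h) b = check s g b ∧ check u h b
  check (s +ₜ u) (g , h) b = check s g b ∧ check u h b
  check (s ×ₜ u) ((g , h) , ws , wu) b =
    (check s g b ∧ check u h b) ∧ (witness-check (mem s g) ws b ∧ witness-check (mem u h) wu b)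

  mem-decides : ∀ t g → Correct t g → Decides (mem t g) (_∈⟦ t ⟧ ρ)
  mem-decides (var j)   _ _ = decides-≡ (ρ j)
  mem-decides (const c) _ _ = decides-≡ c
  mem-decides (compl s) g cs = decides-¬ (mem-decides s g cs)
  mem-decides (s ∪ₜ u) (g , h) (cs , cu) = decides-⊎ (mem-decides s g cs) (mem-decides u h cu)
  mem-decides (s ∩ₜ u) (g , h) (cs , cu) = decides-× (mem-decides s g cs) (mem-decides u h cu)
  mem-decides (s +ₜ u) (g , h) (cs , cu) = decides-⊕ (mem-decides s g cs) (mem-decides u h cu)
  mem-decides (s ×ₜ u) ((g , h) , _) ((cs , cu) , Ws , Wu) =
    decides-⊗ (mem-decides s g cs) (mem-decides u h cu) Ws Wu

  check-correct : ∀ t g → (∀ b → T (check t g b)) ⇔ Correct t g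
  check-correct (var _)   _ = mk⇔ (λ _ → tt) (λ _ _ → tt)
  check-correct (const _) _ = mk⇔ (λ _ → tt) (λ _ _ → tt)
  check-correct (compl s) g = check-correct s g
  check-correct (s ∪ₜ u) (g , h) = (check-correct s g ×-⇔ check-correct u h) ⇔-∘ ∀-T-∧
  check-correct (s ∩ₜ u) (g , h) = (check-correct s g ×-⇔ check-correct u h) ⇔-∘ ∀-T-∧
  check-correct (s +ₜ u) (g , h) = (check-correct s g ×-⇔ check-correct u h) ⇔-∘ ∀-T-∧
  check-correct (s ×ₜ u) ((g , h) , ws , wu) =
    (subterms ×-⇔-dependent witnesses) ⇔-∘ ∀-T-∧ {λ b → check s g b ∧ check u h b}
    where
    subterms : (∀ b → T (check s g b ∧ check u h b)) ⇔ (Correct s g × Correct u h)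
    subterms = (check-correct s g ×-⇔ check-correct u h) ⇔-∘ ∀-T-∧
    witnesses : Correct s g × Correct u h →
                (∀ b → T (witness-check (mem s g) ws b ∧ witness-check (mem u h) wu b)) ⇔
                (IsWitness (_∈⟦ s ⟧ ρ) ws × IsWitness (_∈⟦ u ⟧ ρ) wu)
    witnesses (cs , cu) = (witness-check-correct (mem-decides s g cs) ws
                           ×-⇔ witness-check-correct (mem-decides u h cu) wu) ⇔-∘ ∀-T-∧

  correct-guesses : ExcludedMiddle 0ℓ → ∀ t → Σ (Guesses t) (Correct t)
  correct-guesses lem (var _)   = tt , tt
  correct-guesses lem (const _) = tt , tt
  correct-guesses lem (compl s) = correct-guesses lem s
  correct-guesses lem (s ∪ₜ u) = zip _,_ _,_ (correct-guesses lem s) (correct-guesses lem u)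
  correct-guesses lem (s ∩ₜ u) = zip _,_ _,_ (correct-guesses lem s) (correct-guesses lem u)
  correct-guesses lem (s +ₜ u) = zip _,_ _,_ (correct-guesses lem s) (correct-guesses lem u)
  correct-guesses lem (s ×ₜ u) =
    zip _,_ _,_ (zip _,_ _,_ (correct-guesses lem s) (correct-guesses lem u))
                (zip _,_ _,_ (witness-exists lem _) (witness-exists lem _))

  checkEquation : ∀ e → EquationGuesses e → ℕ → Bool
  checkEquation (s ≐ u) (g , h) b = (check s g b ∧ check u h b) ∧ ⌊ mem s g b ≟ᵇ mem u h b ⌋

  Holds-certified : ExcludedMiddle 0ℓ → ∀ e → Holds e ρ ⇔ (∃[ gs ] ∀ b → T (checkEquation e gs b))
  Holds-certified lem (s ≐ u) = mk⇔
    (λ H → let g , cs = correct-guesses lem s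
               h , cu = correct-guesses lem u
           in (g , h) , from ∀-T-∧ (from (both g h) (cs , cu) , from (agree cs cu) H))
    (λ ((g , h) , all) → let checks , same = to ∀-T-∧ all
                             cs , cu = to (both g h) checks
                         in to (agree cs cu) same)
    where
    both : ∀ g h → (∀ b → T (check s g b ∧ check u h b)) ⇔ (Correct s g × Correct u h)
    both g h = (check-correct s g ×-⇔ check-correct u h) ⇔-∘ ∀-T-∧

    agree : ∀ {g h} → Correct s g → Correct u h →
            (∀ x → T ⌊ mem s g x ≟ᵇ mem u h x ⌋) ⇔ (∀ x → x ∈⟦ s ⟧ ρ ⇔ x ∈⟦ u ⟧ ρ)
    agree {g} {h} cs cu = decides-agree (mem-decides s g cs) (mem-decides u h cu)

-- The values of the variables form a vector, since functions Fin n → ℕ are enumerable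
-- only up to pointwise equality.
Certificate : Instance → Set
Certificate (inst n es) = Vec ℕ n × Certificates EquationGuesses es

ℕ↠Certificate : ∀ I → ℕ ↠ Certificate I
ℕ↠Certificate (inst n es) = ℕ↠× (ℕ↠Vec (↠-id ℕ) n) (ℕ↠Certificates EquationGuesses ℕ↠EquationGuesses es)

checkInstance : ∀ I → Certificate I → ℕ → Bool
checkInstance (inst n es) (v , gs) = checkAll (Guided.checkEquation (lookup v)) es gs

Satisfiable-certified : ExcludedMiddle 0ℓ → ∀ I → Satisfiable I ⇔ (∃[ c ] ∀ b → T (checkInstance I c b))
Satisfiable-certified lem (inst n es) = mk⇔
  (λ (ρ , hs) → let gs , h = to (certified (tabulate ρ))
                                 (All.map (λ {e} → Holds-cong (sym ∘ lookup∘tabulate ρ) e) hs)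
                in (tabulate ρ , gs) , h)
  (λ ((v , gs) , h) → lookup v , from (certified v) (gs , h))
  where
  certified : ∀ v → All (λ e → Holds e (lookup v)) es ⇔
                    (∃[ gs ] ∀ b → T (checkAll (Guided.checkEquation (lookup v)) es gs b))
  certified v = All-certified (Guided.checkEquation (lookup v)) (Guided.Holds-certified (lookup v) lem) es

proposition4 : InΣ₂ Satisfiable
proposition4 = certificates⇒InΣ₂ Certificate ℕ↠Certificate checkInstance Satisfiable-certified
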